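{- Let $G$ be a graph, $u\ne v$ two vertices of $G$, $u_1,\dots,u_s$ ($s\ge1$) leaves adjacent to $u$ and $v_1,\dots,v_t$ ($t\ge1$) leaves adjacent to $v$, where the vertices $u,v,u_1,\dots,u_s,v_1,\dots,v_t$ are pairwise distinct. Let $G_1=G-\{uu_1,\dots,uu_s\}+\{vu_1,\dots,vu_s\}$ and $G_2=G-\{vv_1,\dots,vv_t\}+\{uv_1,\dots,uv_t\}$. Then $F(G_1)>F(G)$ or $F(G_2)>F(G)$.
   Context: All graphs are finite and simple. The F-index is $F(G)=\sum_{v\in V(G)} d_G(v)^3$. A leaf is a vertex of degree $1$. $G-E_1$ denotes deletion of the edge set $E_1$ and $G+E_2$ addition of the edge set $E_2$. -}

module Defs where

open import Data.Nat using (ℕ; _^_)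
open import Data.Bool using (Bool; true; false; _∧_; _∨_; not; if_then_else_)
open import Data.Fin using (Fin; _≟_)
open import Data.Product using (_×_; _,_)
open import Data.List using (List; map; allFin)
open import Data.Nat.ListAction using (sum)
open import Data.Bool.ListAction using (any)
open import Relation.Nullary.Decidable using (⌊_⌋)
open import Relation.Binary.PropositionalEquality using (_≡_)

Adj : ℕ → Set
Adj n = Fin n → Fin n → Bool

record IsSimpleGraph {n : ℕ} (A : Adj n) : Set where
  field
    symmetric   : ∀ x y → A x y ≡ A y x
    irreflexive : ∀ x → A x x ≡ false

deg : {n : ℕ} → Adj n → Fin n → ℕ
deg {n} A x = sum (map (λ y → if A x y then 1 else 0) (allFin n))

Findex : {n : ℕ} → Adj n → ℕ
Findex {n} A = sum (map (λ x → deg A x ^ 3) (allFin n))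

inEdges : {n : ℕ} → List (Fin n × Fin n) → Fin n → Fin n → Bool
inEdges E x y = any (λ { (a , b) → (⌊ a ≟ x ⌋ ∧ ⌊ b ≟ y ⌋) ∨ (⌊ a ≟ y ⌋ ∧ ⌊ b ≟ x ⌋) }) E

deleteEdges : {n : ℕ} → Adj n → List (Fin n × Fin n) → Adj n
deleteEdges A E x y = A x y ∧ not (inEdges E x y)

addEdges : {n : ℕ} → Adj n → List (Fin n × Fin n) → Adj n
addEdges A E x y = A x y ∨ inEdges E x y

star : {n k : ℕ} → Fin n → (Fin k → Fin n) → List (Fin n × Fin n)
star {k = k} w zs = map (λ i → (w , zs i)) (allFin k)

module Submission where

-- Moving the leaves u₁, …, uₛ from u to v lowers d(u) by s, raises d(v) by s and changes no
-- other degree, since the moved leaves keep degree one. With a + s = d(u) and b = d(v), F thus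
-- grows by a³ + (b + s)³ − (a + s)³ − b³, which is positive whenever d(u) ≤ d(v) by convexity
-- of x³. So moving the leaves of the endpoint of smaller degree to the other endpoint increases F.

open import Defs
open import Data.Nat using (ℕ; _≤_; _<_)
open import Data.Bool using (true)
open import Data.Fin using (Fin)
open import Data.List using (_∷_; _++_; tabulate)
open import Data.List.Relation.Unary.Unique.Propositional using (Unique)
open import Data.Sum using (_⊎_)
open import Relation.Binary.PropositionalEquality using (_≡_)

import Algebra.Properties.CommutativeMonoid.Sum as CommutativeMonoidSum
open import Data.Bool using (Bool; false; _∧_; _∨_; not; if_then_else_)
open import Data.Bool.Properties using (∧-zeroʳ; ∧-identityʳ; ∧-inverseʳ; ∨-identityʳ; ∨-zeroʳ; ¬-not)
open import Data.Bool.Solver using (module ∨-∧-Solver)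
open import Data.Bool.ListAction using (any)
open import Data.Empty using (⊥-elim)
open import Data.Fin using (zero; suc; _≟_)
open import Data.Fin.Properties using (suc-injective)
open import Data.List using (List; []; map; length)
open import Data.List.Membership.Propositional using (_∈_; _∉_)
open import Data.List.Properties using (map-tabulate; length-tabulate)
open import Data.List.Relation.Unary.All as All using (All; _∷_)
open import Data.List.Relation.Unary.All.Properties as All using ()
open import Data.List.Relation.Unary.AllPairs using ([]; _∷_)
open import Data.List.Relation.Unary.Any using (here; there)
open import Data.List.Relation.Unary.Unique.Propositional.Properties using (Unique[x∷xs]⇒x∉xs)
open import Data.Nat using (zero; suc; _+_; _*_; _^_; z≤n; s≤s)
open import Data.Nat.ListAction using (sum)
open import Data.Nat.Properties
  using (+-0-commutativeMonoid; +-comm; +-assoc; +-identityʳ; ≤-trans; ≤-total; m≤m+n; m≤n+m;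
         +-monoʳ-≤; +-monoʳ-<; +-cancelʳ-<; m<m+n; m≤n⇒∃[o]m+o≡n)
open import Data.Nat.Solver using (module +-*-Solver)
open import Data.Product using (_×_; _,_)
open import Data.Sum using (inj₁; inj₂)
open import Function using (_∘_)
open import Relation.Binary.PropositionalEquality
  using (_≢_; refl; sym; trans; cong; cong₂; subst; subst₂; ≡-≟-identity; ≢-≟-identity; module ≡-Reasoning)
open import Relation.Nullary using (¬_; yes; no)
open import Relation.Nullary.Decidable using (⌊_⌋)

open CommutativeMonoidSum +-0-commutativeMonoid using (sum-syntax; sum-cong-≗; sum-replicate-zero; ∑-distrib-+)

𝟙 : Bool → ℕ
𝟙 b = if b then 1 else 0

𝟙-∨-disjoint : ∀ a b → (b ≡ true → a ≡ false) → 𝟙 (a ∨ b) ≡ 𝟙 a + 𝟙 b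
𝟙-∨-disjoint a     false _    rewrite ∨-identityʳ a = sym (+-identityʳ (𝟙 a))
𝟙-∨-disjoint a     true  b⇒¬a rewrite b⇒¬a refl = refl

𝟙-split : ∀ a b → (b ≡ true → a ≡ true) → 𝟙 a ≡ 𝟙 (a ∧ not b) + 𝟙 b
𝟙-split a false _ rewrite ∧-identityʳ a = sym (+-identityʳ (𝟙 a))
𝟙-split a true  b⇒a rewrite b⇒a refl = refl

⌊≟⌋-≡ : ∀ {n} {x y : Fin n} → x ≡ y → ⌊ x ≟ y ⌋ ≡ true
⌊≟⌋-≡ x≡y = cong ⌊_⌋ (≡-≟-identity _≟_ x≡y)

⌊≟⌋-≢ : ∀ {n} {x y : Fin n} → x ≢ y → ⌊ x ≟ y ⌋ ≡ false
⌊≟⌋-≢ x≢y = cong ⌊_⌋ (≢-≟-identity _≟_ x≢y)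

sum-map-tabulate : ∀ {A : Set} {k} (f : A → ℕ) (g : Fin k → A) →
                   sum (map f (tabulate g)) ≡ ∑[ i < k ] f (g i)
sum-map-tabulate {k = zero}  f g = refl
sum-map-tabulate {k = suc k} f g = cong (f (g zero) +_) (sum-map-tabulate f (g ∘ suc))

∑-concentrated : ∀ {n} (f : Fin n → ℕ) c → (∀ y → y ≢ c → f y ≡ 0) → ∑[ y < n ] f y ≡ f c
∑-concentrated {suc n} f zero    vanish = begin
  f zero + ∑[ y < n ] f (suc y) ≡⟨ cong (f zero +_) (sum-cong-≗ (λ y → vanish (suc y) λ ()) ) ⟩
  f zero + ∑[ y < n ] 0         ≡⟨ cong (f zero +_) (sum-replicate-zero n) ⟩
  f zero + 0                    ≡⟨ +-identityʳ (f zero) ⟩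
  f zero                        ∎
  where open ≡-Reasoning
∑-concentrated {suc n} f (suc c) vanish =
  cong₂ _+_ (vanish zero λ ()) (∑-concentrated (f ∘ suc) c (λ y y≢c → vanish (suc y) (y≢c ∘ suc-injective)))

∑-𝟙-≟ : ∀ {n} (c : Fin n) → ∑[ y < n ] 𝟙 ⌊ c ≟ y ⌋ ≡ 1
∑-𝟙-≟ c = trans (∑-concentrated _ c (λ y y≢c → cong 𝟙 (⌊≟⌋-≢ (y≢c ∘ sym)))) (cong 𝟙 (⌊≟⌋-≡ refl))

term≤∑ : ∀ {n} (f : Fin n → ℕ) y → f y ≤ ∑[ x < n ] f x
term≤∑ f zero    = m≤m+n _ _
term≤∑ f (suc y) = ≤-trans (term≤∑ (f ∘ suc) y) (m≤n+m _ _)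

two-terms≤∑ : ∀ {n} (f : Fin n → ℕ) {c y} → c ≢ y → f c + f y ≤ ∑[ x < n ] f x
two-terms≤∑ f {zero}  {zero}  c≢y = ⊥-elim (c≢y refl)
two-terms≤∑ f {zero}  {suc y} _   = +-monoʳ-≤ (f zero) (term≤∑ (f ∘ suc) y)
two-terms≤∑ f {suc c} {zero}  _   =
  subst (_≤ f zero + ∑[ x < _ ] f (suc x)) (+-comm (f zero) (f (suc c))) (+-monoʳ-≤ (f zero) (term≤∑ (f ∘ suc) c))
two-terms≤∑ f {suc c} {suc y} c≢y =
  ≤-trans (two-terms≤∑ (f ∘ suc) (c≢y ∘ cong suc)) (m≤n+m _ _)

∑-update : ∀ {n} (f g : Fin n → ℕ) c → (∀ x → x ≢ c → f x ≡ g x) →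
           ∑[ x < n ] f x + g c ≡ ∑[ x < n ] g x + f c
∑-update {suc n} f g zero agree = begin
  f zero + ∑[ x < n ] f (suc x) + g zero ≡⟨ cong (λ t → f zero + t + g zero) (sum-cong-≗ (λ x → agree (suc x) λ ())) ⟩
  f zero + ∑[ x < n ] g (suc x) + g zero ≡⟨ solve 3 (λ a t b → a :+ t :+ b := b :+ t :+ a) refl (f zero) _ (g zero) ⟩
  g zero + ∑[ x < n ] g (suc x) + f zero ∎
  where open ≡-Reasoning; open +-*-Solver
∑-update {suc n} f g (suc c) agree = begin
  f zero + ∑[ x < n ] f (suc x) + g (suc c)   ≡⟨ +-assoc (f zero) _ _ ⟩
  f zero + (∑[ x < n ] f (suc x) + g (suc c)) ≡⟨ cong₂ _+_ (agree zero λ ()) (∑-update (f ∘ suc) (g ∘ suc) c agree-suc) ⟩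
  g zero + (∑[ x < n ] g (suc x) + f (suc c)) ≡⟨ +-assoc (g zero) _ _ ⟨
  g zero + ∑[ x < n ] g (suc x) + f (suc c)   ∎
  where
  open ≡-Reasoning
  agree-suc : ∀ x → x ≢ c → f (suc x) ≡ g (suc x)
  agree-suc x x≢c = agree (suc x) (x≢c ∘ suc-injective)

∑-update₂ : ∀ {n} (f g : Fin n → ℕ) {u v} → u ≢ v → (∀ x → x ≢ u → x ≢ v → f x ≡ g x) →
            ∑[ x < n ] f x + (g u + g v) ≡ ∑[ x < n ] g x + (f u + f v)
∑-update₂ {n} f g {u} {v} u≢v agree = begin
  ∑[ x < n ] f x + (g u + g v) ≡⟨ +-assoc (∑[ x < n ] f x) (g u) (g v) ⟨
  ∑[ x < n ] f x + g u + g v   ≡⟨ cong (λ t → ∑[ x < n ] f x + t + g v) h-u ⟨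
  ∑[ x < n ] f x + h u + g v   ≡⟨ cong (_+ g v) (∑-update f h u f≗h) ⟩
  ∑[ x < n ] h x + f u + g v   ≡⟨ solve 3 (λ t a b → t :+ a :+ b := t :+ b :+ a) refl (∑[ x < n ] h x) (f u) (g v) ⟩
  ∑[ x < n ] h x + g v + f u   ≡⟨ cong (_+ f u) (∑-update h g v h≗g) ⟩
  ∑[ x < n ] g x + h v + f u   ≡⟨ cong (λ t → ∑[ x < n ] g x + t + f u) h-v ⟩
  ∑[ x < n ] g x + f v + f u   ≡⟨ solve 3 (λ t a b → t :+ b :+ a := t :+ (a :+ b)) refl (∑[ x < n ] g x) (f u) (f v) ⟩
  ∑[ x < n ] g x + (f u + f v) ∎
  where
  open ≡-Reasoning
  open +-*-Solver
  -- h agrees with f off u and with g off v, so it bridges two one-point updates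
  h : Fin n → ℕ
  h x = if ⌊ u ≟ x ⌋ then g x else f x
  h-u : h u ≡ g u
  h-u = cong (λ b → if b then g u else f u) (⌊≟⌋-≡ refl)
  h-v : h v ≡ f v
  h-v = cong (λ b → if b then g v else f v) (⌊≟⌋-≢ u≢v)
  f≗h : ∀ x → x ≢ u → f x ≡ h x
  f≗h x x≢u = cong (λ b → if b then g x else f x) (sym (⌊≟⌋-≢ (x≢u ∘ sym)))
  h≗g : ∀ x → x ≢ v → h x ≡ g x
  h≗g x x≢v with u ≟ x
  ... | yes _   = refl
  ... | no  u≢x = agree x (u≢x ∘ sym) x≢v

member : ∀ {n} → List (Fin n) → Fin n → Bool
member ℓs y = any (λ z → ⌊ z ≟ y ⌋) ℓs

member⇒∈ : ∀ {n} (ℓs : List (Fin n)) {y} → member ℓs y ≡ true → y ∈ ℓs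
member⇒∈ (z ∷ ℓs) {y} found with z ≟ y
... | yes refl = here refl
... | no  _    = there (member⇒∈ ℓs found)

∈⇒member : ∀ {n} {ℓs : List (Fin n)} {y} → y ∈ ℓs → member ℓs y ≡ true
∈⇒member {ℓs = _ ∷ ℓs} {y} (here refl)  = cong (_∨ member ℓs y) (⌊≟⌋-≡ refl)
∈⇒member {ℓs = z ∷ _}       (there y∈ℓs) rewrite ∈⇒member y∈ℓs = ∨-zeroʳ ⌊ z ≟ _ ⌋

∉⇒member : ∀ {n} {ℓs : List (Fin n)} {y} → y ∉ ℓs → member ℓs y ≡ false
∉⇒member {ℓs = ℓs} y∉ℓs = ¬-not (y∉ℓs ∘ member⇒∈ ℓs)

∑-member : ∀ {n} {ℓs : List (Fin n)} → Unique ℓs → ∑[ y < n ] 𝟙 (member ℓs y) ≡ length ℓs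
∑-member {n} {[]}     _                          = sum-replicate-zero n
∑-member {n} {z ∷ ℓs} unique@(_ ∷ ℓs-unique) = begin
  ∑[ y < n ] 𝟙 (⌊ z ≟ y ⌋ ∨ member ℓs y)              ≡⟨ sum-cong-≗ disjoint ⟩
  ∑[ y < n ] (𝟙 ⌊ z ≟ y ⌋ + 𝟙 (member ℓs y))          ≡⟨ ∑-distrib-+ (λ y → 𝟙 ⌊ z ≟ y ⌋) (λ y → 𝟙 (member ℓs y)) ⟩
  ∑[ y < n ] 𝟙 ⌊ z ≟ y ⌋ + ∑[ y < n ] 𝟙 (member ℓs y) ≡⟨ cong₂ _+_ (∑-𝟙-≟ z) (∑-member {n} ℓs-unique) ⟩
  1 + length ℓs                                        ∎
  where
  open ≡-Reasoning
  disjoint : ∀ y → 𝟙 (⌊ z ≟ y ⌋ ∨ member ℓs y) ≡ 𝟙 ⌊ z ≟ y ⌋ + 𝟙 (member ℓs y)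
  disjoint y = 𝟙-∨-disjoint ⌊ z ≟ y ⌋ (member ℓs y) λ y∈ℓs →
    ⌊≟⌋-≢ λ { refl → Unique[x∷xs]⇒x∉xs unique (member⇒∈ ℓs y∈ℓs) }

cubes-spread : ∀ a b s → 1 ≤ s → a + s ≤ b → (a + s) ^ 3 + b ^ 3 < a ^ 3 + (b + s) ^ 3
cubes-spread a b s@(suc _) _ a+s≤b with m≤n⇒∃[o]m+o≡n a+s≤b
... | k , refl = subst ((a + s) ^ 3 + (a + s + k) ^ 3 <_) (gap a s k) (m<m+n _ (s≤s z≤n))
  where
  open +-*-Solver
  -- with b = a + s + k the difference of the two sides is 3 s (s + k) (2a + 2s + k)
  gap : ∀ a s k → (a + s) ^ 3 + (a + s + k) ^ 3 + 3 * (s * (s + k) * (s + (s + (a + (a + k)))))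
                  ≡ a ^ 3 + (a + s + k + s) ^ 3
  gap = solve 3 (λ a s k → (a :+ s) :^ 3 :+ (a :+ s :+ k) :^ 3 :+ con 3 :* (s :* (s :+ k) :* (s :+ (s :+ (a :+ (a :+ k)))))
                           := a :^ 3 :+ (a :+ s :+ k :+ s) :^ 3) refl

deg-∑ : ∀ {n} (A : Adj n) x → deg A x ≡ ∑[ y < n ] 𝟙 (A x y)
deg-∑ A x = sum-map-tabulate (λ y → 𝟙 (A x y)) (λ y → y)

deg-cong : ∀ {n} (A B : Adj n) {x x′} → (∀ y → A x y ≡ B x′ y) → deg A x ≡ deg B x′
deg-cong A B {x} {x′} rows = trans (deg-∑ A x) (trans (sum-cong-≗ (cong 𝟙 ∘ rows)) (sym (deg-∑ B x′)))

Findex-∑ : ∀ {n} (A : Adj n) → Findex A ≡ ∑[ x < n ] (deg A x ^ 3)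
Findex-∑ A = sum-map-tabulate (λ x → deg A x ^ 3) (λ x → x)

leaf-row : ∀ {n} (G : Adj n) {ℓ c} → deg G ℓ ≡ 1 → G ℓ c ≡ true → ∀ y → G ℓ y ≡ ⌊ c ≟ y ⌋
leaf-row G {ℓ} {c} deg≡1 Gℓc y with c ≟ y
... | yes refl = Gℓc
... | no  c≢y  = ¬-not λ Gℓy → 2≰1 (subst₂ (λ a b → 𝟙 a + 𝟙 b ≤ 1) Gℓc Gℓy bound)
  where
  bound : 𝟙 (G ℓ c) + 𝟙 (G ℓ y) ≤ 1
  bound = subst (_ ≤_) (trans (sym (deg-∑ G ℓ)) deg≡1) (two-terms≤∑ (λ z → 𝟙 (G ℓ z)) c≢y)
  2≰1 : ¬ 2 ≤ 1
  2≰1 (s≤s ())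

star-tabulate : ∀ {n k} (w : Fin n) (zs : Fin k → Fin n) → star w zs ≡ map (w ,_) (tabulate zs)
star-tabulate w zs = trans (map-tabulate (λ i → i) (λ i → w , zs i)) (sym (map-tabulate zs (w ,_)))

inEdges-map : ∀ {n} (w : Fin n) ℓs x y →
              inEdges (map (w ,_) ℓs) x y ≡ (⌊ w ≟ x ⌋ ∧ member ℓs y) ∨ (⌊ w ≟ y ⌋ ∧ member ℓs x)
inEdges-map w [] x y rewrite ∧-zeroʳ ⌊ w ≟ x ⌋ | ∧-zeroʳ ⌊ w ≟ y ⌋ = refl
inEdges-map w (z ∷ ℓs) x y = trans (cong (_ ∨_) (inEdges-map w ℓs x y)) (
  solve 6 (λ a b c d B D → (a :* b :+ c :* d) :+ (a :* B :+ c :* D) := a :* (b :+ B) :+ c :* (d :+ D))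
        refl ⌊ w ≟ x ⌋ ⌊ z ≟ y ⌋ ⌊ w ≟ y ⌋ ⌊ z ≟ x ⌋ (member ℓs y) (member ℓs x))
  where open ∨-∧-Solver

module LeafTransfer {n} (G : Adj n) (simple : IsSimpleGraph G) {u v : Fin n} {ℓs : List (Fin n)}
  (u≢v : u ≢ v) (unique : Unique ℓs) (v∉ℓs : v ∉ ℓs)
  (adjacent : All (λ ℓ → G u ℓ ≡ true) ℓs) (leaves : All (λ ℓ → deg G ℓ ≡ 1) ℓs) where

  open IsSimpleGraph simple
  open import Data.List.Membership.DecPropositional (_≟_ {n}) using (_∈?_)

  H : Adj n
  H = addEdges (deleteEdges G (map (u ,_) ℓs)) (map (v ,_) ℓs)

  u∉ℓs : u ∉ ℓs
  u∉ℓs u∈ℓs with trans (sym (All.lookup adjacent u∈ℓs)) (irreflexive u)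
  ... | ()

  ∈ℓs⇒≢u : ∀ {ℓ} → ℓ ∈ ℓs → ℓ ≢ u
  ∈ℓs⇒≢u ℓ∈ℓs refl = u∉ℓs ℓ∈ℓs

  ∈ℓs⇒≢v : ∀ {ℓ} → ℓ ∈ ℓs → ℓ ≢ v
  ∈ℓs⇒≢v ℓ∈ℓs refl = v∉ℓs ℓ∈ℓs

  ∈ℓs⇒row : ∀ {ℓ} → ℓ ∈ ℓs → ∀ y → G ℓ y ≡ ⌊ u ≟ y ⌋
  ∈ℓs⇒row ℓ∈ℓs = leaf-row G (All.lookup leaves ℓ∈ℓs) (trans (symmetric _ u) (All.lookup adjacent ℓ∈ℓs))

  H-row : ∀ x y → H x y ≡ (G x y ∧ not ((⌊ u ≟ x ⌋ ∧ member ℓs y) ∨ (⌊ u ≟ y ⌋ ∧ member ℓs x)))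
                          ∨ ((⌊ v ≟ x ⌋ ∧ member ℓs y) ∨ (⌊ v ≟ y ⌋ ∧ member ℓs x))
  H-row x y = cong₂ (λ d a → (G x y ∧ not d) ∨ a) (inEdges-map u ℓs x y) (inEdges-map v ℓs x y)

  H-row-u : ∀ y → H u y ≡ G u y ∧ not (member ℓs y)
  H-row-u y
    rewrite H-row u y | ⌊≟⌋-≡ (refl {x = u}) | ⌊≟⌋-≢ (u≢v ∘ sym) | ∉⇒member u∉ℓs
          | ∧-zeroʳ ⌊ u ≟ y ⌋ | ∧-zeroʳ ⌊ v ≟ y ⌋ | ∨-identityʳ (member ℓs y) = ∨-identityʳ _

  H-row-v : ∀ y → H v y ≡ G v y ∨ member ℓs y
  H-row-v y
    rewrite H-row v y | ⌊≟⌋-≡ (refl {x = v}) | ⌊≟⌋-≢ u≢v | ∉⇒member v∉ℓs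
          | ∧-zeroʳ ⌊ u ≟ y ⌋ | ∧-zeroʳ ⌊ v ≟ y ⌋ | ∨-identityʳ (member ℓs y) | ∧-identityʳ (G v y) = refl

  H-row-ℓ : ∀ {ℓ} → ℓ ∈ ℓs → ∀ y → H ℓ y ≡ ⌊ v ≟ y ⌋
  H-row-ℓ {ℓ} ℓ∈ℓs y
    rewrite H-row ℓ y | ⌊≟⌋-≢ (∈ℓs⇒≢u ℓ∈ℓs ∘ sym) | ⌊≟⌋-≢ (∈ℓs⇒≢v ℓ∈ℓs ∘ sym) | ∈⇒member ℓ∈ℓs | ∈ℓs⇒row ℓ∈ℓs y
          | ∧-identityʳ ⌊ u ≟ y ⌋ | ∧-identityʳ ⌊ v ≟ y ⌋ | ∧-inverseʳ ⌊ u ≟ y ⌋ = refl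

  H-row-other : ∀ {x} → x ≢ u → x ≢ v → x ∉ ℓs → ∀ y → H x y ≡ G x y
  H-row-other {x} x≢u x≢v x∉ℓs y
    rewrite H-row x y | ⌊≟⌋-≢ (x≢u ∘ sym) | ⌊≟⌋-≢ (x≢v ∘ sym) | ∉⇒member x∉ℓs
          | ∧-zeroʳ ⌊ u ≟ y ⌋ | ∧-zeroʳ ⌊ v ≟ y ⌋ | ∧-identityʳ (G x y) = ∨-identityʳ _

  deg-H-u : deg H u + length ℓs ≡ deg G u
  deg-H-u = begin
    deg H u + length ℓs                                          ≡⟨ cong₂ _+_ (deg-∑ H u) (sym (∑-member unique)) ⟩
    ∑[ y < n ] 𝟙 (H u y) + ∑[ y < n ] 𝟙 (member ℓs y)            ≡⟨ ∑-distrib-+ (λ y → 𝟙 (H u y)) (λ y → 𝟙 (member ℓs y)) ⟨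
    ∑[ y < n ] (𝟙 (H u y) + 𝟙 (member ℓs y))                     ≡⟨ sum-cong-≗ split ⟩
    ∑[ y < n ] 𝟙 (G u y)                                         ≡⟨ deg-∑ G u ⟨
    deg G u                                                      ∎
    where
    open ≡-Reasoning
    split : ∀ y → 𝟙 (H u y) + 𝟙 (member ℓs y) ≡ 𝟙 (G u y)
    split y = trans (cong (λ b → 𝟙 b + 𝟙 (member ℓs y)) (H-row-u y))
                    (sym (𝟙-split (G u y) (member ℓs y) (All.lookup adjacent ∘ member⇒∈ ℓs)))

  deg-H-v : deg H v ≡ deg G v + length ℓs
  deg-H-v = begin
    deg H v                                                      ≡⟨ deg-∑ H v ⟩
    ∑[ y < n ] 𝟙 (H v y)                                         ≡⟨ sum-cong-≗ disjoint ⟩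
    ∑[ y < n ] (𝟙 (G v y) + 𝟙 (member ℓs y))                     ≡⟨ ∑-distrib-+ (λ y → 𝟙 (G v y)) (λ y → 𝟙 (member ℓs y)) ⟩
    ∑[ y < n ] 𝟙 (G v y) + ∑[ y < n ] 𝟙 (member ℓs y)            ≡⟨ cong₂ _+_ (sym (deg-∑ G v)) (∑-member unique) ⟩
    deg G v + length ℓs                                          ∎
    where
    open ≡-Reasoning
    leaf-not-at-v : ∀ y → member ℓs y ≡ true → G v y ≡ false
    leaf-not-at-v y y∈ℓs = trans (symmetric v y) (trans (∈ℓs⇒row (member⇒∈ ℓs y∈ℓs) v) (⌊≟⌋-≢ u≢v))
    disjoint : ∀ y → 𝟙 (H v y) ≡ 𝟙 (G v y) + 𝟙 (member ℓs y)
    disjoint y = trans (cong 𝟙 (H-row-v y))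
                       (𝟙-∨-disjoint (G v y) (member ℓs y) (leaf-not-at-v y))

  deg-H-other : ∀ x → x ≢ u → x ≢ v → deg H x ≡ deg G x
  deg-H-other x x≢u x≢v with x ∈? ℓs
  ... | yes x∈ℓs = begin
    deg H x                    ≡⟨ deg-∑ H x ⟩
    ∑[ y < n ] 𝟙 (H x y)       ≡⟨ sum-cong-≗ (cong 𝟙 ∘ H-row-ℓ x∈ℓs) ⟩
    ∑[ y < n ] 𝟙 ⌊ v ≟ y ⌋     ≡⟨ ∑-𝟙-≟ v ⟩
    1                          ≡⟨ All.lookup leaves x∈ℓs ⟨
    deg G x                    ∎
    where open ≡-Reasoning
  ... | no  x∉ℓs = deg-cong H G (H-row-other x≢u x≢v x∉ℓs)

  Findex-balance : Findex H + ((deg H u + length ℓs) ^ 3 + deg G v ^ 3)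
                   ≡ Findex G + (deg H u ^ 3 + (deg G v + length ℓs) ^ 3)
  Findex-balance = begin
    Findex H + ((deg H u + length ℓs) ^ 3 + deg G v ^ 3)   ≡⟨ cong₂ (λ F d → F + (d ^ 3 + deg G v ^ 3)) (Findex-∑ H) deg-H-u ⟩
    ∑[ x < n ] (deg H x ^ 3) + (deg G u ^ 3 + deg G v ^ 3) ≡⟨ ∑-update₂ (λ x → deg H x ^ 3) (λ x → deg G x ^ 3) u≢v cubes-agree ⟩
    ∑[ x < n ] (deg G x ^ 3) + (deg H u ^ 3 + deg H v ^ 3) ≡⟨ cong₂ (λ F d → F + (deg H u ^ 3 + d ^ 3)) (sym (Findex-∑ G)) deg-H-v ⟩
    Findex G + (deg H u ^ 3 + (deg G v + length ℓs) ^ 3)   ∎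
    where
    open ≡-Reasoning
    cubes-agree : ∀ x → x ≢ u → x ≢ v → deg H x ^ 3 ≡ deg G x ^ 3
    cubes-agree x x≢u x≢v = cong (_^ 3) (deg-H-other x x≢u x≢v)

  Findex-increases : 1 ≤ length ℓs → deg G u ≤ deg G v → Findex G < Findex H
  Findex-increases nonempty du≤dv =
    +-cancelʳ-< before (Findex G) (Findex H) (subst (Findex G + before <_) (sym Findex-balance) (+-monoʳ-< (Findex G) spread))
    where
    before : ℕ
    before = (deg H u + length ℓs) ^ 3 + deg G v ^ 3
    spread : before < deg H u ^ 3 + (deg G v + length ℓs) ^ 3
    spread = cubes-spread (deg H u) (deg G v) (length ℓs) nonempty (subst (_≤ deg G v) (sym deg-H-u) du≤dv)

star-transfer-increases-Findex :
  ∀ {n s} (G : Adj n) → IsSimpleGraph G → ∀ {u v} (us : Fin s → Fin n) →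
  1 ≤ s → u ≢ v → Unique (tabulate us) → v ∉ tabulate us →
  (∀ i → G u (us i) ≡ true) → (∀ i → deg G (us i) ≡ 1) → deg G u ≤ deg G v →
  Findex G < Findex (addEdges (deleteEdges G (star u us)) (star v us))
star-transfer-increases-Findex G simple {u} {v} us s≥1 u≢v unique v∉us adjacent leaves du≤dv
  rewrite star-tabulate u us | star-tabulate v us =
  LeafTransfer.Findex-increases G simple u≢v unique v∉us (All.tabulate⁺ adjacent) (All.tabulate⁺ leaves)
    (subst (1 ≤_) (sym (length-tabulate us)) s≥1) du≤dv

Unique-++⁻ : ∀ {A : Set} (xs : List A) {ys} → Unique (xs ++ ys) → Unique xs × Unique ys
Unique-++⁻ []       unique               = [] , unique
Unique-++⁻ (x ∷ xs) (x-fresh ∷ unique) with Unique-++⁻ xs unique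
... | xs-unique , ys-unique = All.++⁻ˡ xs x-fresh ∷ xs-unique , ys-unique

lemma2 : ∀ (n : ℕ) (G : Adj n) → IsSimpleGraph G →
         ∀ (u v : Fin n) (s t : ℕ) (us : Fin s → Fin n) (vs : Fin t → Fin n) →
         1 ≤ s → 1 ≤ t →
         Unique (u ∷ v ∷ tabulate us ++ tabulate vs) →
         (∀ i → G u (us i) ≡ true) → (∀ i → deg G (us i) ≡ 1) →
         (∀ j → G v (vs j) ≡ true) → (∀ j → deg G (vs j) ≡ 1) →
         (Findex G < Findex (addEdges (deleteEdges G (star u us)) (star v us))
          ⊎ Findex G < Findex (addEdges (deleteEdges G (star v vs)) (star u vs)))
lemma2 n G simple u v s t us vs s≥1 t≥1 (u-fresh ∷ v-fresh ∷ unique) adj-u leaves-u adj-v leaves-v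
  with Unique-++⁻ (tabulate us) unique | ≤-total (deg G u) (deg G v)
... | us-unique , _ | inj₁ du≤dv =
  inj₁ (star-transfer-increases-Findex G simple us s≥1 (All.head u-fresh) us-unique
          (All.All¬⇒¬Any (All.++⁻ˡ (tabulate us) v-fresh)) adj-u leaves-u du≤dv)
... | _ , vs-unique | inj₂ dv≤du =
  inj₂ (star-transfer-increases-Findex G simple vs t≥1 (All.head u-fresh ∘ sym) vs-unique
          (All.All¬⇒¬Any (All.++⁻ʳ (tabulate us) (All.tail u-fresh))) adj-v leaves-v dv≤du)
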